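{- Let $\pi$ be a Cayley permutation and write $\pi=B_1B_2\cdots B_k$, where each factor $B_t$ is a maximal strictly decreasing factor (so the last element of $B_t$ is less than or equal to the first element of $B_{t+1}$). Then $\mathcal{TPS}(\pi)=\mathcal{R}(B_1)\cdots\mathcal{R}(B_k)$.
   Context: A Cayley permutation is a finite word $\pi=\pi_1\cdots\pi_n$ over the positive integers such that every integer from $1$ to $\max(\pi)$ occurs at least once. $\mathcal{R}$ denotes word reversal. A tortoise pop-stack processes an input from left to right with a right-greedy algorithm: while the input is nonempty, the next input element is pushed if the resulting stack contents, read from top to bottom, avoid both patterns $21$ and $11$ (i.e. are strictly increasing from top to bottom); otherwise a pop operation is performed, which removes all elements of the stack, appending them to the output in order from top to bottom. When the input is exhausted, the stack is emptied in the same way. $\mathcal{TPS}(\pi)$ denotes the output on input $\pi$. -}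

module Defs where

open import Data.Nat using (ℕ; _<_; _≤_; _>_; _⊔_; _<?_)
open import Data.List using (List; []; _∷_; _++_; foldr)
open import Data.List.NonEmpty using (List⁺; head; last; toList)
open import Data.List.Relation.Unary.All using (All)
open import Data.List.Relation.Unary.Linked using (Linked; linked?)
open import Data.List.Membership.Propositional using (_∈_)
open import Data.Product using (_×_)
open import Relation.Nullary using (yes; no)

maxW : List ℕ → ℕ
maxW = foldr _⊔_ 0

IsCayley : List ℕ → Set
IsCayley π = All (λ x → 1 ≤ x) π × (∀ i → 1 ≤ i → i ≤ maxW π → i ∈ π)

-- stack contents are read top-to-bottom (head of the list = top).
-- A push is allowed iff the resulting contents are strictly increasing
-- top-to-bottom (avoid 21 and 11).
AllowedStack : List ℕ → Set
AllowedStack = Linked _<_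

-- When a push is refused, the stack is popped (output top-to-bottom) and
-- the next iteration pushes x onto the empty stack, which is always allowed;
-- these two steps are performed together to keep the recursion structural.
tpsRun : List ℕ → List ℕ → List ℕ
tpsRun st [] = st
tpsRun st (x ∷ xs) with linked? _<?_ (x ∷ st)
... | yes _ = tpsRun (x ∷ st) xs
... | no _ = st ++ tpsRun (x ∷ []) xs

TPS : List ℕ → List ℕ
TPS π = tpsRun [] π

StrictlyDecreasing : List⁺ ℕ → Set
StrictlyDecreasing B = Linked _>_ (toList B)

MaximalJoin : List⁺ ℕ → List⁺ ℕ → Set
MaximalJoin B C = last B ≤ head C

-- Within a strictly decreasing block every element is smaller than the current
-- top of the stack, so the whole block is pushed and the stack holds its
-- reversal.  At a block boundary the next element is at least the top of the
-- stack, which is the last element of the previous block, so the stack is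
-- popped and emits that block reversed.
module Submission where

open import Defs
open import Data.Nat using (ℕ; _≤_; _>_; _<?_)
open import Data.Nat.Properties using (<⇒≱)
open import Data.List using (List; []; _∷_; _++_; [_]; map; concat; reverse; initLast; _∷ʳ′_)
open import Data.List.Properties using (unfold-reverse; reverse-++; ++-assoc; ++-identityʳ)
open import Data.List.NonEmpty using (List⁺; _∷_; head; tail; last; toList)
open import Data.List.Relation.Unary.All using (All; _∷_)
open import Data.List.Relation.Unary.Linked using (Linked; linked?; [-]; _∷_)
open import Data.Product using (∃; _,_)
open import Relation.Nullary using (yes; no; contradiction)
open import Relation.Binary.PropositionalEquality using (_≡_; refl; sym; cong; module ≡-Reasoning)
open ≡-Reasoning

reverse-toList⁺ : ∀ {A : Set} (xs : List⁺ A) → ∃ λ r → reverse (toList xs) ≡ last xs ∷ r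
reverse-toList⁺ (x ∷ xs) with initLast xs
... | []        = [] , refl
... | ys ∷ʳ′ y = reverse (x ∷ ys) , reverse-++ (x ∷ ys) [ y ]

tpsRun-start : ∀ x xs → tpsRun [] (x ∷ xs) ≡ tpsRun [ x ] xs
tpsRun-start x xs with linked? _<?_ [ x ]
... | yes _ = refl
... | no ¬L = contradiction [-] ¬L

tpsRun-pop : ∀ {t x} r xs → t ≤ x → tpsRun (t ∷ r) (x ∷ xs) ≡ (t ∷ r) ++ tpsRun [ x ] xs
tpsRun-pop {t} {x} r xs t≤x with linked? _<?_ (x ∷ t ∷ r)
... | yes (x<t ∷ _) = contradiction t≤x (<⇒≱ x<t)
... | no _          = refl

tpsRun-pushDecreasing : ∀ a st ys zs → AllowedStack (a ∷ st) → Linked _>_ (a ∷ ys) →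
  tpsRun (a ∷ st) (ys ++ zs) ≡ tpsRun (reverse ys ++ a ∷ st) zs
tpsRun-pushDecreasing a st []       zs _ _ = refl
tpsRun-pushDecreasing a st (y ∷ ys) zs L (y<a ∷ D) with linked? _<?_ (y ∷ a ∷ st)
... | no ¬L = contradiction (y<a ∷ L) ¬L
... | yes L′ = begin
  tpsRun (y ∷ a ∷ st) (ys ++ zs)       ≡⟨ tpsRun-pushDecreasing y (a ∷ st) ys zs L′ D ⟩
  tpsRun (reverse ys ++ [ y ] ++ a ∷ st) zs
    ≡⟨ cong (λ s → tpsRun s zs) (sym (++-assoc (reverse ys) [ y ] (a ∷ st))) ⟩
  tpsRun ((reverse ys ++ [ y ]) ++ a ∷ st) zs
    ≡⟨ cong (λ s → tpsRun (s ++ a ∷ st) zs) (sym (unfold-reverse y ys)) ⟩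
  tpsRun (reverse (y ∷ ys) ++ a ∷ st) zs ∎

tpsRun-block : ∀ B zs → StrictlyDecreasing B →
  tpsRun [ head B ] (tail B ++ zs) ≡ tpsRun (reverse (toList B)) zs
tpsRun-block (b ∷ bs) zs D = begin
  tpsRun [ b ] (bs ++ zs)            ≡⟨ tpsRun-pushDecreasing b [] bs zs [-] D ⟩
  tpsRun (reverse bs ++ [ b ]) zs    ≡⟨ cong (λ s → tpsRun s zs) (sym (unfold-reverse b bs)) ⟩
  tpsRun (reverse (b ∷ bs)) zs       ∎

tpsRun-blocks : ∀ B rest → All StrictlyDecreasing rest → Linked MaximalJoin (B ∷ rest) →
  tpsRun (reverse (toList B)) (concat (map toList rest))
    ≡ reverse (toList B) ++ concat (map (λ C → reverse (toList C)) rest)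
tpsRun-blocks B []       _        _           = sym (++-identityʳ _)
tpsRun-blocks B (C ∷ rest) (D ∷ Ds) (B≤C ∷ J) with reverse-toList⁺ B
... | r , revB≡ = begin
  tpsRun (reverse (toList B)) (head C ∷ tail C ++ zs)
    ≡⟨ cong (λ s → tpsRun s (head C ∷ tail C ++ zs)) revB≡ ⟩
  tpsRun (last B ∷ r) (head C ∷ tail C ++ zs)
    ≡⟨ tpsRun-pop r (tail C ++ zs) B≤C ⟩
  (last B ∷ r) ++ tpsRun [ head C ] (tail C ++ zs)
    ≡⟨ cong (_++ tpsRun [ head C ] (tail C ++ zs)) (sym revB≡) ⟩
  reverse (toList B) ++ tpsRun [ head C ] (tail C ++ zs)
    ≡⟨ cong (reverse (toList B) ++_) (tpsRun-block C zs D) ⟩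
  reverse (toList B) ++ tpsRun (reverse (toList C)) zs
    ≡⟨ cong (reverse (toList B) ++_) (tpsRun-blocks C rest Ds J) ⟩
  reverse (toList B) ++ reverse (toList C) ++ concat (map (λ C → reverse (toList C)) rest) ∎
  where zs = concat (map toList rest)

TPS-concat-decreasingBlocks : ∀ blocks → All StrictlyDecreasing blocks → Linked MaximalJoin blocks →
  TPS (concat (map toList blocks)) ≡ concat (map (λ B → reverse (toList B)) blocks)
TPS-concat-decreasingBlocks []         _        _ = refl
TPS-concat-decreasingBlocks (B ∷ rest) (D ∷ Ds) J = begin
  tpsRun [] (head B ∷ tail B ++ zs)    ≡⟨ tpsRun-start (head B) (tail B ++ zs) ⟩
  tpsRun [ head B ] (tail B ++ zs)     ≡⟨ tpsRun-block B zs D ⟩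
  tpsRun (reverse (toList B)) zs       ≡⟨ tpsRun-blocks B rest Ds J ⟩
  concat (map (λ B → reverse (toList B)) (B ∷ rest)) ∎
  where zs = concat (map toList rest)

lemma5 : (π : List ℕ) → IsCayley π →
    (blocks : List (List⁺ ℕ)) →
    concat (map toList blocks) ≡ π →
    All StrictlyDecreasing blocks →
    Linked MaximalJoin blocks →
    TPS π ≡ concat (map (λ B → reverse (toList B)) blocks)
lemma5 π _ blocks refl = TPS-concat-decreasingBlocks blocks
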